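{- Let $\ell\equiv 0 \pmod 4$ be a positive integer. If there exists a Hadamard matrix of order $\ell$, then there exists an $\left(\ell^2, \binom{\ell}{2}, \frac{\ell(\ell-2)}{4}\right)$-BIBD admitting a $0$-ULSE $\ell$-colouring.
   Context: A Hadamard matrix of order $n$ is an $n\times n$ matrix with entries in $\{ -1,1\}$ whose rows are pairwise orthogonal. For positive integers $v,k,\lambda$ with $2\le k<v$, a $(v,k,\lambda)$-BIBD is a pair $(V,\mathcal{B})$ where $V$ is a set of $v$ points and $\mathcal{B}$ is a collection of $k$-element subsets of $V$ (blocks) such that every pair of distinct points lies in exactly $\lambda$ blocks. An $\ell$-colouring of a BIBD is a surjective map from $V$ onto a set of $\ell$ colours. A $0$-ULSE $\ell$-colouring is an $\ell$-colouring such that $(\ell-1)$ divides $k$ and in every block exactly one colour does not appear, while each of the other $\ell-1$ colours appears exactly $\frac{k}{\ell-1}$ times in that block. -}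

module Defs where

open import Data.Nat using (ℕ; zero; suc; _+_; _*_; _∸_; _≤_; _<_)
open import Data.Nat.Divisibility using (_∣_)
open import Data.Integer as ℤ using (ℤ; +_; -[1+_])
open import Data.Fin using (Fin)
open import Data.Fin.Subset using (Subset; _∈_; _∉_; ∣_∣)
open import Data.List using (List; []; _∷_)
open import Data.Product using (Σ; ∃; _×_; _,_)
open import Data.Sum using (_⊎_)
open import Function using (Surjective)
open import Relation.Binary.PropositionalEquality using (_≡_)
open import Relation.Nullary using (¬_; Dec; yes; no)

ΣFin : (n : ℕ) → (Fin n → ℤ) → ℤ
ΣFin zero    f = + 0
ΣFin (suc n) f = f Fin.zero ℤ.+ ΣFin n (λ i → f (Fin.suc i))

countFin : (n : ℕ) → {P : Fin n → Set} → ((i : Fin n) → Dec (P i)) → ℕ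
countFin zero    P? = 0
countFin (suc n) P? with P? Fin.zero
... | yes _ = suc (countFin n (λ i → P? (Fin.suc i)))
... | no  _ = countFin n (λ i → P? (Fin.suc i))

countList : {A : Set} {P : A → Set} → ((a : A) → Dec (P a)) → List A → ℕ
countList P? []      = 0
countList P? (x ∷ xs) with P? x
... | yes _ = suc (countList P? xs)
... | no  _ = countList P? xs

IsHadamard : (n : ℕ) → (Fin n → Fin n → ℤ) → Set
IsHadamard n H =
  (∀ i j → (H i j ≡ + 1) ⊎ (H i j ≡ -[1+ 0 ]))
  × (∀ i j → ¬ (i ≡ j) → ΣFin n (λ t → H i t ℤ.* H j t) ≡ + 0)

HadamardExists : ℕ → Set
HadamardExists n = Σ (Fin n → Fin n → ℤ) (IsHadamard n)

-- BIBDs. Point set V = Fin v; the blocks form a finite collection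
-- (a list, so repeated blocks are allowed) of subsets of V.

pairCount : {v : ℕ} → List (Subset v) → Fin v → Fin v → ℕ
pairCount {v} ℬ x y = countList (λ B → both B) ℬ
  where
  open import Data.Fin.Subset.Properties using (_∈?_)
  open import Relation.Nullary.Decidable using (_×-dec_)
  both : (B : Subset v) → Dec ((x ∈ B) × (y ∈ B))
  both B = (x ∈? B) ×-dec (y ∈? B)

IsBIBD : (v k λ' : ℕ) → List (Subset v) → Set
IsBIBD v k λ' ℬ =
  (2 ≤ k) × (k < v)
  × (∀ B → B Data.List.Membership.Propositional.∈ ℬ → ∣ B ∣ ≡ k)
  × (∀ x y → ¬ (x ≡ y) → pairCount ℬ x y ≡ λ')
  where import Data.List.Membership.Propositional

colourCount : {v ℓ : ℕ} → (Fin v → Fin ℓ) → Subset v → Fin ℓ → ℕ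
colourCount {v} c B a = countFin v (λ x → inB x)
  where
  open import Data.Fin.Subset.Properties using (_∈?_)
  open import Relation.Nullary.Decidable using (_×-dec_)
  import Data.Fin.Properties as FP
  inB : (x : Fin v) → Dec ((x ∈ B) × (c x ≡ a))
  inB x = (x ∈? B) ×-dec (c x FP.≟ a)

IsColouring : (v ℓ : ℕ) → (Fin v → Fin ℓ) → Set
IsColouring v ℓ c = Surjective _≡_ _≡_ c

-- 0-ULSE ℓ-colouring of a BIBD with block size k and blocks ℬ:
-- (ℓ-1) ∣ k, and in every block exactly one colour does not appear,
-- while every other colour appears exactly k/(ℓ-1) times
-- (written multiplicatively: count * (ℓ-1) ≡ k).
Is0ULSE : (v k ℓ : ℕ) → List (Subset v) → (Fin v → Fin ℓ) → Set
Is0ULSE v k ℓ ℬ c =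
  IsColouring v ℓ c
  × ((ℓ ∸ 1) ∣ k)
  × (∀ B → B Data.List.Membership.Propositional.∈ ℬ →
       Σ (Fin ℓ) λ a →
         (colourCount c B a ≡ 0)
         × (∀ b → ¬ (b ≡ a) → colourCount c B b * (ℓ ∸ 1) ≡ k))
  where import Data.List.Membership.Propositional

BIBDWith0ULSE : (v k λ' ℓ : ℕ) → Set
BIBDWith0ULSE v k λ' ℓ =
  Σ (List (Subset v)) λ ℬ → IsBIBD v k λ' ℬ × Σ (Fin v → Fin ℓ) (Is0ULSE v k ℓ ℬ)

module Submission where

-- Normalise the Hadamard matrix of order N so that its first row is all ones, giving G.
-- Points are pairs (b , x) of a colour b and a column x; for a, r : Fin N the block
-- B(a , r) consists of the points (b , x) such that the row m = a + b (mod N) is not the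
-- first row and G m x = G m r.  Colour −a is missing from B(a , r), and every other
-- colour b meets it in the N/2 columns where row a + b agrees with its entry in column r.
-- All counts are integer sums of indicators, evaluated with 2·[s = t] = 1 + s t for signs
-- s, t.  As the rows other than the first are balanced and pairwise orthogonal, two points
-- of distinct colours lie together in N/4 blocks for each of the N − 2 values of a that
-- send neither colour to the first row; as the columns are orthogonal too, points (b , x)
-- and (b , y) lie together in N/2 blocks for each of the (N − 2)/2 rows other than the
-- first on which columns x and y agree.  Either way λ = N (N − 2)/4.

open import Defs
open import Data.Fin using (Fin; zero)
open import Data.Integer using (ℤ; +_)
open import Data.Nat using (ℕ; suc)
open import Relation.Binary.PropositionalEquality using (_≡_)

module FiniteSums where

  open import Data.Bool using (Bool; true; false; _∧_)
  open import Data.Fin using (Fin; zero; suc; _↑ˡ_; _↑ʳ_; combine; remQuot)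
  open import Data.Fin.Properties using (_≟_; remQuot-combine)
  open import Data.Fin.Subset using (∣_∣)
  open import Data.Fin.Subset.Properties using (_∈?_)
  open import Data.Integer using (ℤ; +_; _+_; _*_; _≤_)
  import Data.Integer.Properties as ℤₚ
  import Data.List as List
  open import Data.Nat as ℕ using (ℕ)
  open import Data.Product using (uncurry)
  import Data.Vec as Vec
  open import Relation.Binary.PropositionalEquality
  open import Relation.Nullary using (Dec; does; yes; no; ¬_; contradiction)

  open import Algebra.Properties.Semiring.Sum ℤₚ.+-*-semiring public
    using (sum; sum-syntax; sum-cong-≗; ∑-distrib-+; ∑-comm; ∑-permute; *-distribˡ-sum; *-distribʳ-sum)

  ∑-cong : ∀ {n} {f g : Fin n → ℤ} → (∀ i → f i ≡ g i) → ∑[ i < n ] f i ≡ ∑[ i < n ] g i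
  ∑-cong = sum-cong-≗

  𝟙 : Bool → ℤ
  𝟙 true  = + 1
  𝟙 false = + 0

  𝟙-∧ : ∀ a b → 𝟙 (a ∧ b) ≡ 𝟙 a * 𝟙 b
  𝟙-∧ true  b = sym (ℤₚ.*-identityˡ (𝟙 b))
  𝟙-∧ false b = refl

  δ : ∀ {n} → Fin n → Fin n → ℤ
  δ i j = 𝟙 (does (i ≟ j))

  δ-≢ : ∀ {n} {i j : Fin n} → ¬ i ≡ j → δ i j ≡ + 0
  δ-≢ {i = i} {j} i≢j with i ≟ j
  ... | yes i≡j = contradiction i≡j i≢j
  ... | no  _   = refl

  ∑-const : ∀ n c → ∑[ i < n ] c ≡ + n * c
  ∑-const ℕ.zero    c = refl
  ∑-const (ℕ.suc n) c = begin
    c + ∑[ i < n ] c  ≡⟨ cong (_+_ c) (∑-const n c) ⟩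
    c + + n * c       ≡⟨ cong (_+ + n * c) (ℤₚ.*-identityˡ c) ⟨
    + 1 * c + + n * c ≡⟨ ℤₚ.*-distribʳ-+ c (+ 1) (+ n) ⟨
    + ℕ.suc n * c     ∎
    where open ≡-Reasoning

  ∑-1 : ∀ n → ∑[ i < n ] (+ 1) ≡ + n
  ∑-1 n = trans (∑-const n (+ 1)) (ℤₚ.*-identityʳ (+ n))

  ∑-δ : ∀ n (j : Fin n) (f : Fin n → ℤ) → ∑[ i < n ] (δ i j * f i) ≡ f j
  ∑-δ (ℕ.suc n) zero f = begin
    + 1 * f zero + ∑[ i < n ] (δ (suc i) zero * f (suc i)) ≡⟨ cong₂ _+_ (ℤₚ.*-identityˡ (f zero)) (∑-const n (+ 0)) ⟩
    f zero + + n * + 0                                      ≡⟨ cong (_+_ (f zero)) (ℤₚ.*-zeroʳ (+ n)) ⟩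
    f zero + + 0                                            ≡⟨ ℤₚ.+-identityʳ (f zero) ⟩
    f zero                                                  ∎
    where open ≡-Reasoning
  ∑-δ (ℕ.suc n) (suc j) f = begin
    + 0 * f zero + ∑[ i < n ] (δ i j * f (suc i)) ≡⟨ ℤₚ.+-identityˡ _ ⟩
    ∑[ i < n ] (δ i j * f (suc i))                ≡⟨ ∑-δ n j (λ i → f (suc i)) ⟩
    f (suc j)                                     ∎
    where open ≡-Reasoning

  ∑-nonneg : ∀ n (f : Fin n → ℤ) → (∀ i → + 0 ≤ f i) → + 0 ≤ ∑[ i < n ] f i
  ∑-nonneg ℕ.zero    f f≥0 = ℤₚ.≤-refl
  ∑-nonneg (ℕ.suc n) f f≥0 = ℤₚ.+-mono-≤ (f≥0 zero) (∑-nonneg n (λ i → f (suc i)) (λ i → f≥0 (suc i)))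

  ∑-nonneg-≡0 : ∀ n (f : Fin n → ℤ) → (∀ i → + 0 ≤ f i) → ∑[ i < n ] f i ≡ + 0 → ∀ i → f i ≡ + 0
  ∑-nonneg-≡0 (ℕ.suc n) f f≥0 ∑f≡0 = λ where
      zero    → head≡0
      (suc i) → ∑-nonneg-≡0 n (λ i → f (suc i)) (λ i → f≥0 (suc i)) tail≡0 i
    where
    tail≥0 : + 0 ≤ ∑[ i < n ] f (suc i)
    tail≥0 = ∑-nonneg n (λ i → f (suc i)) (λ i → f≥0 (suc i))
    head≡0 : f zero ≡ + 0
    head≡0 = ℤₚ.≤-antisym (begin
      f zero                          ≡⟨ ℤₚ.+-identityʳ (f zero) ⟨
      f zero + + 0                    ≤⟨ ℤₚ.+-monoʳ-≤ (f zero) tail≥0 ⟩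
      f zero + ∑[ i < n ] f (suc i)   ≡⟨ ∑f≡0 ⟩
      + 0                             ∎) (f≥0 zero)
      where open ℤₚ.≤-Reasoning
    tail≡0 : ∑[ i < n ] f (suc i) ≡ + 0
    tail≡0 = trans (sym (ℤₚ.+-identityˡ _)) (trans (cong (_+ ∑[ i < n ] f (suc i)) (sym head≡0)) ∑f≡0)

  ∑-↑ : ∀ m n (f : Fin (m ℕ.+ n) → ℤ) → ∑[ k < m ℕ.+ n ] f k ≡ ∑[ i < m ] f (i ↑ˡ n) + ∑[ j < n ] f (m ↑ʳ j)
  ∑-↑ ℕ.zero    n f = sym (ℤₚ.+-identityˡ _)
  ∑-↑ (ℕ.suc m) n f = trans (cong (_+_ (f zero)) (∑-↑ m n (λ k → f (suc k)))) (sym (ℤₚ.+-assoc (f zero) _ _))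

  ∑-combine : ∀ m n (f : Fin (m ℕ.* n) → ℤ) → ∑[ k < m ℕ.* n ] f k ≡ ∑[ i < m ] ∑[ j < n ] f (combine i j)
  ∑-combine ℕ.zero    n f = refl
  ∑-combine (ℕ.suc m) n f =
    trans (∑-↑ n (m ℕ.* n) f) (cong (_+_ (∑[ j < n ] f (j ↑ˡ m ℕ.* n))) (∑-combine m n (λ k → f (n ↑ʳ k))))

  ∑-remQuot : ∀ m n (f : Fin m → Fin n → ℤ) → ∑[ k < m ℕ.* n ] uncurry f (remQuot n k) ≡ ∑[ i < m ] ∑[ j < n ] f i j
  ∑-remQuot m n f = trans (∑-combine m n _) (∑-cong λ i → ∑-cong λ j → cong (uncurry f) (remQuot-combine i j))

  ∑*∑ : ∀ m n (f : Fin m → ℤ) (g : Fin n → ℤ) → (∑[ i < m ] f i) * (∑[ j < n ] g j) ≡ ∑[ i < m ] ∑[ j < n ] (f i * g j)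
  ∑*∑ m n f g = trans (*-distribʳ-sum _ f) (∑-cong λ i → *-distribˡ-sum (f i) g)

  ΣFin≡∑ : ∀ n f → ΣFin n f ≡ ∑[ i < n ] f i
  ΣFin≡∑ ℕ.zero    f = refl
  ΣFin≡∑ (ℕ.suc n) f = cong (_+_ (f zero)) (ΣFin≡∑ n (λ i → f (suc i)))

  countFin≡∑ : ∀ n {P : Fin n → Set} (P? : ∀ i → Dec (P i)) → + countFin n P? ≡ ∑[ i < n ] 𝟙 (does (P? i))
  countFin≡∑ ℕ.zero    P? = refl
  countFin≡∑ (ℕ.suc n) P? with P? zero
  ... | yes _ = cong (_+_ (+ 1)) (countFin≡∑ n (λ i → P? (suc i)))
  ... | no  _ = trans (countFin≡∑ n (λ i → P? (suc i))) (sym (ℤₚ.+-identityˡ _))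

  countList-tabulate≡∑ : ∀ {A : Set} {P : A → Set} (P? : ∀ a → Dec (P a)) n (f : Fin n → A) →
                       + countList P? (List.tabulate f) ≡ ∑[ i < n ] 𝟙 (does (P? (f i)))
  countList-tabulate≡∑ P? ℕ.zero    f = refl
  countList-tabulate≡∑ P? (ℕ.suc n) f with P? (f zero)
  ... | yes _ = cong (_+_ (+ 1)) (countList-tabulate≡∑ P? n (λ i → f (suc i)))
  ... | no  _ = trans (countList-tabulate≡∑ P? n (λ i → f (suc i))) (sym (ℤₚ.+-identityˡ _))

  ∣tabulate∣≡∑ : ∀ n (f : Fin n → Bool) → + ∣ Vec.tabulate f ∣ ≡ ∑[ i < n ] 𝟙 (f i)
  ∣tabulate∣≡∑ ℕ.zero    f = refl
  ∣tabulate∣≡∑ (ℕ.suc n) f with f zero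
  ... | true  = cong (_+_ (+ 1)) (∣tabulate∣≡∑ n (λ i → f (suc i)))
  ... | false = trans (∣tabulate∣≡∑ n (λ i → f (suc i))) (sym (ℤₚ.+-identityˡ _))

  ∈?-tabulate : ∀ n (f : Fin n → Bool) x → does (x ∈? Vec.tabulate f) ≡ f x
  ∈?-tabulate (ℕ.suc n) f zero with f zero
  ... | true  = refl
  ... | false = refl
  ∈?-tabulate (ℕ.suc n) f (suc x) = ∈?-tabulate n (λ i → f (suc i)) x

  +*+-injective : ∀ a b c d → + a * + b ≡ + c * + d → a ℕ.* b ≡ c ℕ.* d
  +*+-injective a b c d eq = ℤₚ.+-injective (trans (ℤₚ.pos-* a b) (trans eq (sym (ℤₚ.pos-* c d))))

module HadamardMatrices where

  open FiniteSums
  open import Data.Bool using (true; false)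
  open import Data.Fin using (Fin; zero; suc)
  open import Data.Fin.Properties using (_≟_)
  open import Data.Integer as ℤ using (ℤ; +_; -[1+_]; _+_; _*_; -_; _-_; _≤_; +≤+)
  import Data.Integer.Properties as ℤₚ
  open import Data.Integer.Tactic.RingSolver using (solve-∀)
  open import Data.Nat as ℕ using (ℕ; z≤n)
  open import Data.Product using (_,_; proj₁; proj₂)
  open import Data.Sum using (_⊎_; inj₁; inj₂; [_,_]′)
  open import Function using (_∘_; id)
  open import Relation.Binary.PropositionalEquality
  open import Relation.Nullary using (does; yes; no; ¬_)

  IsSign : ℤ → Set
  IsSign s = (s ≡ + 1) ⊎ (s ≡ -[1+ 0 ])

  sign² : ∀ {s} → IsSign s → s * s ≡ + 1
  sign² (inj₁ refl) = refl
  sign² (inj₂ refl) = refl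

  sign-* : ∀ {s t} → IsSign s → IsSign t → IsSign (s * t)
  sign-* (inj₁ refl) (inj₁ refl) = inj₁ refl
  sign-* (inj₁ refl) (inj₂ refl) = inj₂ refl
  sign-* (inj₂ refl) (inj₁ refl) = inj₂ refl
  sign-* (inj₂ refl) (inj₂ refl) = inj₁ refl

  2*𝟙[s≟t]≡1+s*t : ∀ {s t} → IsSign s → IsSign t → + 2 * 𝟙 (does (s ℤ.≟ t)) ≡ + 1 + s * t
  2*𝟙[s≟t]≡1+s*t (inj₁ refl) (inj₁ refl) = refl
  2*𝟙[s≟t]≡1+s*t (inj₁ refl) (inj₂ refl) = refl
  2*𝟙[s≟t]≡1+s*t (inj₂ refl) (inj₁ refl) = refl
  2*𝟙[s≟t]≡1+s*t (inj₂ refl) (inj₂ refl) = refl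

  ∑-signs² : ∀ {n} {f : Fin n → ℤ} → (∀ i → IsSign (f i)) → ∑[ i < n ] (f i * f i) ≡ + n
  ∑-signs² {n} f± = trans (∑-cong λ i → sign² (f± i)) (∑-1 n)

  0≤i*i : ∀ i → + 0 ≤ i * i
  0≤i*i (+ n)     = subst (+ 0 ≤_) (ℤₚ.pos-* n n) (+≤+ z≤n)
  0≤i*i -[1+ n ]  = +≤+ z≤n

  i*i≡0⇒i≡0 : ∀ i → i * i ≡ + 0 → i ≡ + 0
  i*i≡0⇒i≡0 i i²≡0 = [ id , id ]′ (ℤₚ.i*j≡0⇒i≡0∨j≡0 i i²≡0)

  module _ {n : ℕ} {H : Fin n → Fin n → ℤ} (had : IsHadamard n H) where

    hadamard-sign : ∀ i j → IsSign (H i j)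
    hadamard-sign = proj₁ had

    hadamard-orthogonal : ∀ i j → ¬ i ≡ j → ∑[ t < n ] (H i t * H j t) ≡ + 0
    hadamard-orthogonal i j i≢j = trans (sym (ΣFin≡∑ n _)) (proj₂ had i j i≢j)

    hadamard-row² : ∀ i → ∑[ t < n ] (H i t * H i t) ≡ + n
    hadamard-row² i = ∑-signs² (hadamard-sign i)

    hadamard-gram : ∀ i j → ∑[ t < n ] (H i t * H j t) ≡ δ i j * + n
    hadamard-gram i j with i ≟ j
    ... | yes refl = trans (hadamard-row² i) (sym (ℤₚ.*-identityˡ (+ n)))
    ... | no  i≢j  = hadamard-orthogonal i j i≢j

  mkHadamard : ∀ {n} {H : Fin n → Fin n → ℤ} → (∀ i j → IsSign (H i j)) →
               (∀ i j → ¬ i ≡ j → ∑[ t < n ] (H i t * H j t) ≡ + 0) → IsHadamard n H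
  mkHadamard {n} signs orth = signs , λ i j i≢j → trans (ΣFin≡∑ n _) (orth i j i≢j)

  isHadamard-scaleColumns : ∀ {n} {H : Fin n → Fin n → ℤ} (d : Fin n → ℤ) → (∀ j → IsSign (d j)) →
                            IsHadamard n H → IsHadamard n (λ i j → H i j * d j)
  isHadamard-scaleColumns {n} {H} d d± had = mkHadamard
    (λ i j → sign-* (hadamard-sign had i j) (d± j))
    (λ i j i≢j → trans (∑-cong λ t → cancel (H i t) (H j t) (d t) (sign² (d± t))) (hadamard-orthogonal had i j i≢j))
    where
    cancel : ∀ a b c → c * c ≡ + 1 → (a * c) * (b * c) ≡ a * b
    cancel a b c c²≡1 = trans (rearrange a b c) (trans (cong (_*_ (a * b)) c²≡1) (ℤₚ.*-identityʳ (a * b)))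
      where
      rearrange : ∀ a b c → (a * c) * (b * c) ≡ (a * b) * (c * c)
      rearrange = solve-∀

  ∑∑[AᵀA]²≡∑∑[AAᵀ]² : ∀ p q (A : Fin p → Fin q → ℤ) →
          ∑[ x < q ] ∑[ y < q ] ((∑[ m < p ] (A m x * A m y)) * (∑[ k < p ] (A k x * A k y))) ≡
          ∑[ m < p ] ∑[ k < p ] ((∑[ x < q ] (A m x * A k x)) * (∑[ y < q ] (A m y * A k y)))
  ∑∑[AᵀA]²≡∑∑[AAᵀ]² p q A = begin
    ∑[ x < q ] ∑[ y < q ] ((∑[ m < p ] (A m x * A m y)) * (∑[ k < p ] (A k x * A k y)))
      ≡⟨ ∑-cong (λ x → ∑-cong λ y → ∑*∑ p p (λ m → A m x * A m y) (λ k → A k x * A k y)) ⟩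
    ∑[ x < q ] ∑[ y < q ] ∑[ m < p ] ∑[ k < p ] T m k x y
      ≡⟨ ∑-cong (λ x → trans (∑-comm λ y m → ∑[ k < p ] T m k x y) (∑-cong λ m → ∑-comm λ y k → T m k x y)) ⟩
    ∑[ x < q ] ∑[ m < p ] ∑[ k < p ] ∑[ y < q ] T m k x y
      ≡⟨ trans (∑-comm λ x m → ∑[ k < p ] ∑[ y < q ] T m k x y) (∑-cong λ m → ∑-comm λ x k → ∑[ y < q ] T m k x y) ⟩
    ∑[ m < p ] ∑[ k < p ] ∑[ x < q ] ∑[ y < q ] T m k x y
      ≡⟨ ∑-cong (λ m → ∑-cong λ k → ∑-cong λ x → ∑-cong λ y → swap (A m x) (A m y) (A k x) (A k y)) ⟩
    ∑[ m < p ] ∑[ k < p ] ∑[ x < q ] ∑[ y < q ] ((A m x * A k x) * (A m y * A k y))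
      ≡⟨ ∑-cong (λ m → ∑-cong λ k → ∑*∑ q q (λ x → A m x * A k x) (λ y → A m y * A k y)) ⟨
    ∑[ m < p ] ∑[ k < p ] ((∑[ x < q ] (A m x * A k x)) * (∑[ y < q ] (A m y * A k y)))
      ∎
    where
    open ≡-Reasoning
    T : Fin p → Fin p → Fin q → Fin q → ℤ
    T m k x y = (A m x * A m y) * (A k x * A k y)
    swap : ∀ a b c d → (a * b) * (c * d) ≡ (a * c) * (b * d)
    swap = solve-∀

  -- The entries of HᵀH and of HHᵀ = n I have the same sum of squares n³, and the n
  -- diagonal entries of HᵀH, all equal to n, already account for it.
  module _ {n : ℕ} {H : Fin n → Fin n → ℤ} (had : IsHadamard n H) where

    private
      C : Fin n → Fin n → ℤ
      C x y = ∑[ m < n ] (H m x * H m y)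

      N² : ℤ
      N² = + n * + n

      ∑∑C² : ∑[ x < n ] ∑[ y < n ] (C x y * C x y) ≡ + n * N²
      ∑∑C² = begin
        ∑[ x < n ] ∑[ y < n ] (C x y * C x y)
          ≡⟨ ∑∑[AᵀA]²≡∑∑[AAᵀ]² n n H ⟩
        ∑[ m < n ] ∑[ k < n ] (∑[ x < n ] (H m x * H k x) * ∑[ y < n ] (H m y * H k y))
          ≡⟨ ∑-cong (λ m → ∑-cong λ k → cong (λ g → g * g) (hadamard-gram had m k)) ⟩
        ∑[ m < n ] ∑[ k < n ] ((δ m k * + n) * (δ m k * + n))
          ≡⟨ ∑-cong (λ m → ∑-cong {n} λ k → 𝟙-square (does (m ≟ k))) ⟩
        ∑[ m < n ] ∑[ k < n ] (δ m k * N²)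
          ≡⟨ ∑-comm {n} {n} (λ m k → δ m k * N²) ⟩
        ∑[ k < n ] ∑[ m < n ] (δ m k * N²)
          ≡⟨ ∑-cong (λ k → ∑-δ n k (λ _ → N²)) ⟩
        ∑[ k < n ] N²
          ≡⟨ ∑-const n N² ⟩
        + n * N²
          ∎
        where
        open ≡-Reasoning
        𝟙-square : ∀ b → (𝟙 b * + n) * (𝟙 b * + n) ≡ 𝟙 b * N²
        𝟙-square false = refl
        𝟙-square true  = trans (cong₂ _*_ (ℤₚ.*-identityˡ (+ n)) (ℤₚ.*-identityˡ (+ n))) (sym (ℤₚ.*-identityˡ N²))

      D : Fin n → Fin n → ℤ
      D x y = C x y * C x y - δ y x * N²

      C-diagonal : ∀ x → C x x ≡ + n
      C-diagonal x = ∑-signs² (λ m → hadamard-sign had m x)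

      D≥0 : ∀ x y → + 0 ≤ D x y
      D≥0 x y with y ≟ x
      ... | yes refl = ℤₚ.≤-reflexive (sym (begin
        C x x * C x x - + 1 * N² ≡⟨ cong₂ (λ c d → c * c - d) (C-diagonal x) (ℤₚ.*-identityˡ N²) ⟩
        N² - N²                  ≡⟨ ℤₚ.+-inverseʳ N² ⟩
        + 0                      ∎))
        where open ≡-Reasoning
      ... | no  _    = subst (+ 0 ≤_) (sym (ℤₚ.+-identityʳ (C x y * C x y))) (0≤i*i (C x y))

      ∑∑D≡0 : ∑[ x < n ] ∑[ y < n ] D x y ≡ + 0
      ∑∑D≡0 = begin
        ∑[ x < n ] ∑[ y < n ] D x y
          ≡⟨ ∑-cong (λ x → ∑-distrib-+ (λ y → C x y * C x y) (λ y → - (δ y x * N²))) ⟩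
        ∑[ x < n ] (∑[ y < n ] (C x y * C x y) + ∑[ y < n ] (- (δ y x * N²)))
          ≡⟨ ∑-distrib-+ (λ x → ∑[ y < n ] (C x y * C x y)) (λ x → ∑[ y < n ] (- (δ y x * N²))) ⟩
        ∑[ x < n ] ∑[ y < n ] (C x y * C x y) + ∑[ x < n ] ∑[ y < n ] (- (δ y x * N²))
          ≡⟨ cong₂ _+_ ∑∑C² (∑-cong λ x → trans (∑-cong λ y → ℤₚ.neg-distribʳ-* (δ y x) N²) (∑-δ n x (λ _ → - N²))) ⟩
        + n * N² + ∑[ x < n ] (- N²)
          ≡⟨ cong (_+_ (+ n * N²)) (∑-const n (- N²)) ⟩
        + n * N² + + n * - N²
          ≡⟨ cancel (+ n) N² ⟩
        + 0 ∎
        where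
        open ≡-Reasoning
        cancel : ∀ a b → a * b + a * - b ≡ + 0
        cancel = solve-∀

    isHadamard-transpose : IsHadamard n (λ i j → H j i)
    isHadamard-transpose = mkHadamard (λ i j → hadamard-sign had j i) columns-orthogonal
      where
      columns-orthogonal : ∀ x y → ¬ x ≡ y → C x y ≡ + 0
      columns-orthogonal x y x≢y = i*i≡0⇒i≡0 (C x y) C²≡0
        where
        D≡0 : D x y ≡ + 0
        D≡0 = ∑-nonneg-≡0 n (D x) (D≥0 x)
                (∑-nonneg-≡0 n (λ x → ∑[ y < n ] D x y) (λ x → ∑-nonneg n (D x) (D≥0 x)) ∑∑D≡0 x) y
        C²≡0 : C x y * C x y ≡ + 0
        C²≡0 = begin
          C x y * C x y               ≡⟨ ℤₚ.+-identityʳ (C x y * C x y) ⟨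
          C x y * C x y - + 0 * N²    ≡⟨ cong (λ d → C x y * C x y - d * N²) (δ-≢ (x≢y ∘ sym)) ⟨
          D x y                       ≡⟨ D≡0 ⟩
          + 0                         ∎
          where open ≡-Reasoning

  normalise : ∀ {n} → (Fin (ℕ.suc n) → Fin (ℕ.suc n) → ℤ) → Fin (ℕ.suc n) → Fin (ℕ.suc n) → ℤ
  normalise H i j = H i j * H zero j

  module _ {n : ℕ} {H : Fin (ℕ.suc n) → Fin (ℕ.suc n) → ℤ} (had : IsHadamard (ℕ.suc n) H) where

    isHadamard-normalise : IsHadamard (ℕ.suc n) (normalise H)
    isHadamard-normalise = isHadamard-scaleColumns (H zero) (hadamard-sign had zero) had

    normalise-firstRow : ∀ j → normalise H zero j ≡ + 1
    normalise-firstRow j = sign² (hadamard-sign had zero j)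

  module Normalised {n : ℕ} {G : Fin (ℕ.suc n) → Fin (ℕ.suc n) → ℤ}
                    (had : IsHadamard (ℕ.suc n) G) (firstRow : ∀ j → G zero j ≡ + 1) where

    rowSum≡0 : ∀ i → ¬ i ≡ zero → ∑[ j < ℕ.suc n ] G i j ≡ + 0
    rowSum≡0 i i≢0 = trans (∑-cong λ j → sym (trans (cong (G i j *_) (firstRow j)) (ℤₚ.*-identityʳ (G i j))))
                           (hadamard-orthogonal had i zero i≢0)

    columnProduct-belowFirstRow≡-1 : ∀ x y → ¬ x ≡ y → ∑[ m < n ] (G (suc m) x * G (suc m) y) ≡ -[1+ 0 ]
    columnProduct-belowFirstRow≡-1 x y x≢y = begin
      S                                 ≡⟨ shift S ⟩
      + 1 * + 1 + S - + 1               ≡⟨ cong (λ c → c + S - + 1) (cong₂ _*_ (firstRow x) (firstRow y)) ⟨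
      G zero x * G zero y + S - + 1     ≡⟨ cong (_- + 1) (hadamard-orthogonal (isHadamard-transpose had) x y x≢y) ⟩
      + 0 - + 1                         ∎
      where
      open ≡-Reasoning
      S : ℤ
      S = ∑[ m < n ] (G (suc m) x * G (suc m) y)
      shift : ∀ s → s ≡ + 1 * + 1 + s - + 1
      shift = solve-∀

module CyclicGroup where

  open FiniteSums using (sum-syntax; ∑-permute)
  open import Data.Fin using (Fin; zero; toℕ)
  open import Data.Fin.Permutation using (Permutation′; permutation)
  open import Data.Fin.Properties using (toℕ-fromℕ<; toℕ-injective; toℕ<n; toℕ≤n)
  open import Data.Nat using (ℕ; suc; _+_; _∸_; _%_)
  open import Data.Nat.DivMod using (_mod_; %-distribˡ-+; m%n%n≡m%n; [m+n]%n≡m%n; m<n⇒m%n≡m)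
  open import Data.Nat.Properties using (+-identityʳ; +-comm; +-assoc; m∸n+n≡m; m+[n∸m]≡n)
  open import Relation.Binary.PropositionalEquality

  module _ {n : ℕ} where

    infixl 6 _⊕_

    _⊕_ : Fin (suc n) → Fin (suc n) → Fin (suc n)
    i ⊕ j = (toℕ i + toℕ j) mod suc n

    ⊖_ : Fin (suc n) → Fin (suc n)
    ⊖ i = (suc n ∸ toℕ i) mod suc n

    ⊕-comm : ∀ i j → i ⊕ j ≡ j ⊕ i
    ⊕-comm i j = cong (_mod suc n) (+-comm (toℕ i) (toℕ j))

    private
      toℕ-mod : ∀ m → toℕ (m mod suc n) ≡ m % suc n
      toℕ-mod m = toℕ-fromℕ< _

      [a%N+b]%N : ∀ a b → (a % suc n + b) % suc n ≡ (a + b) % suc n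
      [a%N+b]%N a b = begin
        (a % suc n + b) % suc n                   ≡⟨ %-distribˡ-+ (a % suc n) b (suc n) ⟩
        (a % suc n % suc n + b % suc n) % suc n   ≡⟨ cong (λ m → (m + b % suc n) % suc n) (m%n%n≡m%n a (suc n)) ⟩
        (a % suc n + b % suc n) % suc n           ≡⟨ %-distribˡ-+ a b (suc n) ⟨
        (a + b) % suc n                           ∎
        where open ≡-Reasoning

      [a+b%N]%N : ∀ a b → (a + b % suc n) % suc n ≡ (a + b) % suc n
      [a+b%N]%N a b = trans (cong (_% suc n) (+-comm a (b % suc n)))
                            (trans ([a%N+b]%N b a) (cong (_% suc n) (+-comm b a)))

      [N+j]%N : ∀ j → (suc n + toℕ j) % suc n ≡ toℕ j
      [N+j]%N j = trans (cong (_% suc n) (+-comm (suc n) (toℕ j)))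
                        (trans ([m+n]%n≡m%n (toℕ j) (suc n)) (m<n⇒m%n≡m (toℕ<n j)))

    ⊖-⊕-cancel : ∀ i j → (⊖ i) ⊕ (i ⊕ j) ≡ j
    ⊖-⊕-cancel i j = toℕ-injective (begin
      toℕ ((⊖ i) ⊕ (i ⊕ j))                                  ≡⟨ toℕ-mod (toℕ (⊖ i) + toℕ (i ⊕ j)) ⟩
      (toℕ (⊖ i) + toℕ (i ⊕ j)) % suc n
        ≡⟨ cong₂ (λ a b → (a + b) % suc n) (toℕ-mod (suc n ∸ toℕ i)) (toℕ-mod (toℕ i + toℕ j)) ⟩
      ((suc n ∸ toℕ i) % suc n + (toℕ i + toℕ j) % suc n) % suc n ≡⟨ %-distribˡ-+ (suc n ∸ toℕ i) (toℕ i + toℕ j) (suc n) ⟨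
      (suc n ∸ toℕ i + (toℕ i + toℕ j)) % suc n              ≡⟨ cong (_% suc n) (+-assoc (suc n ∸ toℕ i) (toℕ i) (toℕ j)) ⟨
      (suc n ∸ toℕ i + toℕ i + toℕ j) % suc n                ≡⟨ cong (λ m → (m + toℕ j) % suc n) (m∸n+n≡m (toℕ≤n i)) ⟩
      (suc n + toℕ j) % suc n                                ≡⟨ [N+j]%N j ⟩
      toℕ j                                                  ∎)
      where open ≡-Reasoning

    ⊕-⊖-cancel : ∀ i j → i ⊕ ((⊖ i) ⊕ j) ≡ j
    ⊕-⊖-cancel i j = toℕ-injective (begin
      toℕ (i ⊕ ((⊖ i) ⊕ j))                                  ≡⟨ toℕ-mod (toℕ i + toℕ ((⊖ i) ⊕ j)) ⟩
      (toℕ i + toℕ ((⊖ i) ⊕ j)) % suc n                      ≡⟨ cong (λ m → (toℕ i + m) % suc n) (toℕ-mod (toℕ (⊖ i) + toℕ j)) ⟩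
      (toℕ i + (toℕ (⊖ i) + toℕ j) % suc n) % suc n          ≡⟨ cong (λ m → (toℕ i + (m + toℕ j) % suc n) % suc n) (toℕ-mod (suc n ∸ toℕ i)) ⟩
      (toℕ i + ((suc n ∸ toℕ i) % suc n + toℕ j) % suc n) % suc n ≡⟨ cong (λ m → (toℕ i + m) % suc n) ([a%N+b]%N (suc n ∸ toℕ i) (toℕ j)) ⟩
      (toℕ i + (suc n ∸ toℕ i + toℕ j) % suc n) % suc n      ≡⟨ [a+b%N]%N (toℕ i) (suc n ∸ toℕ i + toℕ j) ⟩
      (toℕ i + (suc n ∸ toℕ i + toℕ j)) % suc n              ≡⟨ cong (_% suc n) (+-assoc (toℕ i) (suc n ∸ toℕ i) (toℕ j)) ⟨
      (toℕ i + (suc n ∸ toℕ i) + toℕ j) % suc n              ≡⟨ cong (λ m → (m + toℕ j) % suc n) (m+[n∸m]≡n (toℕ≤n i)) ⟩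
      (suc n + toℕ j) % suc n                                ≡⟨ [N+j]%N j ⟩
      toℕ j                                                  ∎)
      where open ≡-Reasoning

    ⊕-identityʳ : ∀ i → i ⊕ zero ≡ i
    ⊕-identityʳ i = toℕ-injective (begin
      toℕ (i ⊕ zero)        ≡⟨ toℕ-mod (toℕ i + 0) ⟩
      (toℕ i + 0) % suc n   ≡⟨ cong (_% suc n) (+-identityʳ (toℕ i)) ⟩
      toℕ i % suc n         ≡⟨ m<n⇒m%n≡m (toℕ<n i) ⟩
      toℕ i                 ∎)
      where open ≡-Reasoning

    ⊕-inverseʳ : ∀ i → i ⊕ (⊖ i) ≡ zero
    ⊕-inverseʳ i = trans (cong (i ⊕_) (sym (⊕-identityʳ (⊖ i)))) (⊕-⊖-cancel i zero)

    ⊕-cancelˡ : ∀ i {j k} → i ⊕ j ≡ i ⊕ k → j ≡ k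
    ⊕-cancelˡ i {j} {k} eq = trans (sym (⊖-⊕-cancel i j)) (trans (cong ((⊖ i) ⊕_) eq) (⊖-⊕-cancel i k))

    ⊕-permutation : Fin (suc n) → Permutation′ (suc n)
    ⊕-permutation i = permutation (i ⊕_) ((⊖ i) ⊕_) (⊕-⊖-cancel i) (⊖-⊕-cancel i)

    ∑-⊕ : ∀ i (f : Fin (suc n) → ℤ) → ∑[ j < suc n ] f (i ⊕ j) ≡ ∑[ j < suc n ] f j
    ∑-⊕ i f = sym (∑-permute f (⊕-permutation i))

module DesignParameters where

  open import Data.Fin using (Fin)
  open import Data.Fin.Subset using (Subset; ∣_∣)
  open import Data.List using (List)
  open import Data.List.Membership.Propositional using (_∈_)
  open import Data.Nat using (ℕ; zero; suc; _+_; _*_; _∸_; _/_; _≤_; _<_; z≤n; s≤s)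
  open import Data.Nat.Combinatorics using (_C_; nC1≡n; nCk+nC[k+1]≡[n+1]C[k+1]; k>n⇒nCk≡0)
  open import Data.Nat.DivMod using (m*n/n≡m)
  open import Data.Nat.Divisibility using (_∣_; divides)
  open import Data.Nat.Properties
  open import Data.Nat.Tactic.RingSolver using (solve-∀)
  open import Data.Product using (Σ; _×_; _,_)
  open import Relation.Binary.PropositionalEquality
  open import Relation.Nullary using (¬_)

  2*[1+n]C2≡[1+n]*n : ∀ n → 2 * (suc n C 2) ≡ suc n * n
  2*[1+n]C2≡[1+n]*n zero    = cong (2 *_) (k>n⇒nCk≡0 {1} {2} (s≤s (s≤s z≤n)))
  2*[1+n]C2≡[1+n]*n (suc n) = begin
    2 * (suc (suc n) C 2)               ≡⟨ cong (2 *_) (nCk+nC[k+1]≡[n+1]C[k+1] (suc n) 1) ⟨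
    2 * (suc n C 1 + suc n C 2)         ≡⟨ cong (λ c → 2 * (c + suc n C 2)) (nC1≡n (suc n)) ⟩
    2 * (suc n + suc n C 2)             ≡⟨ *-distribˡ-+ 2 (suc n) (suc n C 2) ⟩
    2 * suc n + 2 * (suc n C 2)         ≡⟨ cong (_+_ (2 * suc n)) (2*[1+n]C2≡[1+n]*n n) ⟩
    2 * suc n + suc n * n               ≡⟨ step n ⟩
    suc (suc n) * suc n                 ∎
    where
    open ≡-Reasoning
    step : ∀ n → 2 * suc n + suc n * n ≡ suc (suc n) * suc n
    step = solve-∀

  module _ {n : ℕ} (2∣N : 2 ∣ suc n) (2≤n : 2 ≤ n) where

    private
      N k : ℕ
      N = suc n
      k = N C 2

      2k≡Nn : 2 * k ≡ N * n
      2k≡Nn = 2*[1+n]C2≡[1+n]*n n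

      halve : ∀ a → 2 * a ≡ N * n → a ≡ k
      halve a 2a≡Nn = *-cancelˡ-≡ a k 2 (trans 2a≡Nn (sym 2k≡Nn))

      2≤k : 2 ≤ k
      2≤k = *-cancelˡ-≤ 2 (≤-trans (*-mono-≤ (m≤n⇒m≤1+n 2≤n) 2≤n) (≤-reflexive (sym 2k≡Nn)))

      k<N*N : k < N * N
      k<N*N = ≤-<-trans (m≤n*m k 2) (subst (_< N * N) (sym 2k≡Nn) (*-monoʳ-< N (n<1+n n)))

      N∸1∣k : (N ∸ 1) ∣ k
      N∸1∣k = divides h (sym (halve (h * n) (begin
        2 * (h * n)   ≡⟨ *-assoc 2 h n ⟨
        2 * h * n     ≡⟨ cong (_* n) (trans (*-comm 2 h) (sym N≡h*2)) ⟩
        N * n         ∎)))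
        where
        open ≡-Reasoning
        open _∣_ 2∣N renaming (quotient to h; equality to N≡h*2)

      c≡λ : ∀ c → 4 * c + N ≡ N * n → c ≡ (N * (N ∸ 2)) / 4
      c≡λ c 4c+N≡Nn = sym (trans (cong (_/ 4) (trans N*[n∸1]≡4c (*-comm 4 c))) (m*n/n≡m c 4))
        where
        N*[n∸1]≡4c : N * (n ∸ 1) ≡ 4 * c
        N*[n∸1]≡4c = begin
          N * (n ∸ 1)        ≡⟨ *-distribˡ-∸ N n 1 ⟩
          N * n ∸ N * 1      ≡⟨ cong₂ _∸_ (sym 4c+N≡Nn) (*-identityʳ N) ⟩
          4 * c + N ∸ N      ≡⟨ m+n∸n≡m (4 * c) N ⟩
          4 * c              ∎
          where open ≡-Reasoning

      c*[N∸1]≡k : ∀ c → 2 * c ≡ N → c * (N ∸ 1) ≡ k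
      c*[N∸1]≡k c 2c≡N = halve (c * n) (trans (sym (*-assoc 2 c n)) (cong (_* n) 2c≡N))

    -- The pair condition says 4 λ = N (N − 2), moved around so that no subtraction occurs.
    bibdWith0ULSE-fromCounts :
      (ℬ : List (Subset (N * N))) (c : Fin (N * N) → Fin N) → IsColouring (N * N) N c →
      (∀ B → B ∈ ℬ → 2 * ∣ B ∣ ≡ N * n) →
      (∀ x y → ¬ x ≡ y → 4 * pairCount ℬ x y + N ≡ N * n) →
      (∀ B → B ∈ ℬ → Σ (Fin N) λ a → colourCount c B a ≡ 0 × (∀ b → ¬ b ≡ a → 2 * colourCount c B b ≡ N)) →
      BIBDWith0ULSE (N * N) k ((N * (N ∸ 2)) / 4) N
    bibdWith0ULSE-fromCounts ℬ c c-surjective sizes pairs colours =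
      ℬ , (2≤k , k<N*N , (λ B B∈ℬ → halve ∣ B ∣ (sizes B B∈ℬ)) , (λ x y x≢y → c≡λ (pairCount ℬ x y) (pairs x y x≢y))) ,
      c , c-surjective , N∸1∣k , λ B B∈ℬ → ulse B (colours B B∈ℬ)
      where
      ulse : ∀ B → Σ (Fin N) (λ a → colourCount c B a ≡ 0 × (∀ b → ¬ b ≡ a → 2 * colourCount c B b ≡ N)) →
             Σ (Fin N) (λ a → colourCount c B a ≡ 0 × (∀ b → ¬ b ≡ a → colourCount c B b * (N ∸ 1) ≡ k))
      ulse B (a , missing , present) = a , missing , λ b b≢a → c*[N∸1]≡k (colourCount c B b) (present b b≢a)

module Construction {n : ℕ} {G : Fin (suc n) → Fin (suc n) → ℤ}
                    (had : IsHadamard (suc n) G) (firstRow : ∀ j → G zero j ≡ + 1) where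

  open FiniteSums
  open HadamardMatrices
  open Normalised had firstRow
  open CyclicGroup
  open DesignParameters
  open import Data.Bool using (Bool; true; false; _∧_)
  open import Data.Fin using (Fin; zero; suc; remQuot; quotient; combine)
  open import Data.Fin.Properties using (_≟_; combine-remQuot; remQuot-combine)
  open import Data.Fin.Subset using (Subset; ∣_∣)
  open import Data.Fin.Subset.Properties using (_∈?_)
  open import Data.Integer as ℤ using (ℤ; +_; -[1+_]; _+_; _*_; -_; _-_)
  import Data.Integer.Properties as ℤₚ
  open import Data.Integer.Tactic.RingSolver using (solve-∀)
  open import Data.List as List using (List)
  open import Data.List.Membership.Propositional using (_∈_)
  open import Data.List.Membership.Propositional.Properties using (∈-tabulate⁻)
  open import Data.Nat as ℕ using (ℕ)
  import Data.Nat.Properties as ℕₚ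
  open import Data.Nat.Combinatorics using (_C_)
  open import Data.Nat.Divisibility using (_∣_)
  open import Data.Nat.DivMod using (_/_)
  open import Data.Product using (Σ; _×_; _,_; proj₁; proj₂; uncurry)
  import Data.Vec as Vec
  open import Function using (_∘_)
  open import Relation.Binary.PropositionalEquality
  open import Relation.Nullary using (does; yes; no; ¬_; contradiction)
  open import Relation.Nullary.Decidable using (_×-dec_)

  N : ℕ
  N = suc n

  nonzero : Fin N → Bool
  nonzero zero    = false
  nonzero (suc _) = true

  ν : Fin N → ℤ
  ν m = 𝟙 (nonzero m)

  member : (m r x : Fin N) → Bool
  member m r x = nonzero m ∧ does (G m x ℤ.≟ G m r)

  2*𝟙[member] : ∀ m r x → + 2 * 𝟙 (member m r x) ≡ ν m * (+ 1 + G m x * G m r)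
  2*𝟙[member] m r x = begin
    + 2 * 𝟙 (member m r x)    ≡⟨ cong (+ 2 *_) (𝟙-∧ (nonzero m) _) ⟩
    + 2 * (ν m * e)           ≡⟨ swap (+ 2) (ν m) e ⟩
    ν m * (+ 2 * e)           ≡⟨ cong (ν m *_) (2*𝟙[s≟t]≡1+s*t (hadamard-sign had m x) (hadamard-sign had m r)) ⟩
    ν m * (+ 1 + G m x * G m r) ∎
    where
    open ≡-Reasoning
    e : ℤ
    e = 𝟙 (does (G m x ℤ.≟ G m r))
    swap : ∀ a b c → a * (b * c) ≡ b * (a * c)
    swap = solve-∀

  ν*rowSum≡0 : ∀ m → ν m * ∑[ x < N ] G m x ≡ + 0
  ν*rowSum≡0 zero    = refl
  ν*rowSum≡0 (suc m) = trans (ℤₚ.*-identityˡ _) (rowSum≡0 (suc m) λ ())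

  2*∑member≡ν*N : ∀ m r → + 2 * ∑[ x < N ] 𝟙 (member m r x) ≡ ν m * + N
  2*∑member≡ν*N m r = begin
    + 2 * ∑[ x < N ] 𝟙 (member m r x)                 ≡⟨ *-distribˡ-sum (+ 2) (λ x → 𝟙 (member m r x)) ⟩
    ∑[ x < N ] (+ 2 * 𝟙 (member m r x))               ≡⟨ ∑-cong (2*𝟙[member] m r) ⟩
    ∑[ x < N ] (ν m * (+ 1 + G m x * G m r))          ≡⟨ *-distribˡ-sum (ν m) (λ x → + 1 + G m x * G m r) ⟨
    ν m * ∑[ x < N ] (+ 1 + G m x * G m r)            ≡⟨ cong (ν m *_) (∑-distrib-+ (λ _ → + 1) (λ x → G m x * G m r)) ⟩
    ν m * (∑[ x < N ] (+ 1) + ∑[ x < N ] (G m x * G m r)) ≡⟨ cong₂ (λ a b → ν m * (a + b)) (∑-1 N) (sym (*-distribʳ-sum (G m r) (G m))) ⟩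
    ν m * (+ N + (∑[ x < N ] G m x) * G m r)          ≡⟨ distrib (ν m) (+ N) (∑[ x < N ] G m x) (G m r) ⟩
    ν m * + N + (ν m * ∑[ x < N ] G m x) * G m r      ≡⟨ cong (λ a → ν m * + N + a * G m r) (ν*rowSum≡0 m) ⟩
    ν m * + N + + 0 * G m r                           ≡⟨ ℤₚ.+-identityʳ (ν m * + N) ⟩
    ν m * + N ∎
    where
    open ≡-Reasoning
    distrib : ∀ a b c d → a * (b + c * d) ≡ a * b + (a * c) * d
    distrib = solve-∀

  ∑-expand : ∀ (s t : ℤ) (u w : Fin N → ℤ) →
             ∑[ r < N ] ((+ 1 + s * u r) * (+ 1 + t * w r)) ≡
             + N + s * ∑[ r < N ] u r + t * ∑[ r < N ] w r + (s * t) * ∑[ r < N ] (u r * w r)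
  ∑-expand s t u w = begin
    ∑[ r < N ] ((+ 1 + s * u r) * (+ 1 + t * w r))
      ≡⟨ ∑-cong (λ r → expand s t (u r) (w r)) ⟩
    ∑[ r < N ] (+ 1 + s * u r + t * w r + (s * t) * (u r * w r))
      ≡⟨ ∑-distrib-+ (λ r → + 1 + s * u r + t * w r) (λ r → (s * t) * (u r * w r)) ⟩
    ∑[ r < N ] (+ 1 + s * u r + t * w r) + ∑[ r < N ] ((s * t) * (u r * w r))
      ≡⟨ cong (_+ ∑[ r < N ] ((s * t) * (u r * w r))) (∑-distrib-+ (λ r → + 1 + s * u r) (λ r → t * w r)) ⟩
    ∑[ r < N ] (+ 1 + s * u r) + ∑[ r < N ] (t * w r) + ∑[ r < N ] ((s * t) * (u r * w r))
      ≡⟨ cong (λ a → a + ∑[ r < N ] (t * w r) + ∑[ r < N ] ((s * t) * (u r * w r))) (∑-distrib-+ (λ _ → + 1) (λ r → s * u r)) ⟩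
    ∑[ r < N ] (+ 1) + ∑[ r < N ] (s * u r) + ∑[ r < N ] (t * w r) + ∑[ r < N ] ((s * t) * (u r * w r))
      ≡⟨ cong₂ (λ a b → a + b + ∑[ r < N ] (t * w r) + ∑[ r < N ] ((s * t) * (u r * w r))) (∑-1 N) (sym (*-distribˡ-sum s u)) ⟩
    + N + s * ∑[ r < N ] u r + ∑[ r < N ] (t * w r) + ∑[ r < N ] ((s * t) * (u r * w r))
      ≡⟨ cong₂ (λ a b → + N + s * ∑[ r < N ] u r + a + b) (sym (*-distribˡ-sum t w)) (sym (*-distribˡ-sum (s * t) (λ r → u r * w r))) ⟩
    + N + s * ∑[ r < N ] u r + t * ∑[ r < N ] w r + (s * t) * ∑[ r < N ] (u r * w r)
      ∎
    where
    open ≡-Reasoning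
    expand : ∀ s t a b → (+ 1 + s * a) * (+ 1 + t * b) ≡ + 1 + s * a + t * b + (s * t) * (a * b)
    expand = solve-∀

  4*∑member*member : ∀ m m' x y →
    + 4 * ∑[ r < N ] (𝟙 (member m r x) * 𝟙 (member m' r y)) ≡
    (ν m * ν m') * (+ N + (G m x * G m' y) * ∑[ r < N ] (G m r * G m' r))
  4*∑member*member m m' x y = begin
    + 4 * ∑[ r < N ] (𝟙 (member m r x) * 𝟙 (member m' r y))
      ≡⟨ *-distribˡ-sum (+ 4) (λ r → 𝟙 (member m r x) * 𝟙 (member m' r y)) ⟩
    ∑[ r < N ] (+ 4 * (𝟙 (member m r x) * 𝟙 (member m' r y)))
      ≡⟨ ∑-cong (λ r → trans (split (𝟙 (member m r x)) (𝟙 (member m' r y))) (cong₂ _*_ (2*𝟙[member] m r x) (2*𝟙[member] m' r y))) ⟩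
    ∑[ r < N ] ((ν m * (+ 1 + s * G m r)) * (ν m' * (+ 1 + t * G m' r)))
      ≡⟨ ∑-cong (λ r → regroup (ν m) (ν m') (+ 1 + s * G m r) (+ 1 + t * G m' r)) ⟩
    ∑[ r < N ] ((ν m * ν m') * ((+ 1 + s * G m r) * (+ 1 + t * G m' r)))
      ≡⟨ *-distribˡ-sum (ν m * ν m') (λ r → (+ 1 + s * G m r) * (+ 1 + t * G m' r)) ⟨
    (ν m * ν m') * ∑[ r < N ] ((+ 1 + s * G m r) * (+ 1 + t * G m' r))
      ≡⟨ cong ((ν m * ν m') *_) (∑-expand s t (G m) (G m')) ⟩
    (ν m * ν m') * (+ N + s * ∑[ r < N ] G m r + t * ∑[ r < N ] G m' r + (s * t) * P)
      ≡⟨ collect (ν m) (ν m') (+ N) s t (∑[ r < N ] G m r) (∑[ r < N ] G m' r) P ⟩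
    (ν m * ν m') * (+ N + (s * t) * P) + (ν m' * s) * (ν m * ∑[ r < N ] G m r) + (ν m * t) * (ν m' * ∑[ r < N ] G m' r)
      ≡⟨ cong₂ (λ a b → (ν m * ν m') * (+ N + (s * t) * P) + (ν m' * s) * a + (ν m * t) * b) (ν*rowSum≡0 m) (ν*rowSum≡0 m') ⟩
    (ν m * ν m') * (+ N + (s * t) * P) + (ν m' * s) * + 0 + (ν m * t) * + 0
      ≡⟨ drop ((ν m * ν m') * (+ N + (s * t) * P)) (ν m' * s) (ν m * t) ⟩
    (ν m * ν m') * (+ N + (s * t) * P)
      ∎
    where
    open ≡-Reasoning
    s t P : ℤ
    s = G m x
    t = G m' y
    P = ∑[ r < N ] (G m r * G m' r)
    split : ∀ a b → + 4 * (a * b) ≡ (+ 2 * a) * (+ 2 * b)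
    split = solve-∀
    regroup : ∀ a b c d → (a * c) * (b * d) ≡ (a * b) * (c * d)
    regroup = solve-∀
    collect : ∀ a b n s t u w p → (a * b) * (n + s * u + t * w + (s * t) * p) ≡ (a * b) * (n + (s * t) * p) + (b * s) * (a * u) + (a * t) * (b * w)
    collect = solve-∀
    drop : ∀ a b c → a + b * + 0 + c * + 0 ≡ a
    drop = solve-∀

  ∑ν : ∑[ m < N ] ν m ≡ + n
  ∑ν = trans (ℤₚ.+-identityˡ _) (∑-1 n)

  ∑-ν⊕ : ∀ b → ∑[ a < N ] ν (a ⊕ b) ≡ + n
  ∑-ν⊕ b = trans (∑-cong λ a → cong ν (⊕-comm a b)) (trans (∑-⊕ b ν) ∑ν)

  ν² : ∀ m → ν m * ν m ≡ ν m
  ν² zero    = refl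
  ν² (suc _) = refl

  ν*ν≡ν+ν-1 : ∀ {m m'} → ¬ m ≡ m' → ν m * ν m' ≡ ν m + ν m' - + 1
  ν*ν≡ν+ν-1 {zero}  {zero}  m≢m' = contradiction refl m≢m'
  ν*ν≡ν+ν-1 {zero}  {suc _} _    = refl
  ν*ν≡ν+ν-1 {suc _} {zero}  _    = refl
  ν*ν≡ν+ν-1 {suc _} {suc _} _    = refl

  ∑-ν⊕*ν⊕ : ∀ {b b'} → ¬ b ≡ b' → ∑[ a < N ] (ν (a ⊕ b) * ν (a ⊕ b')) ≡ + n - + 1
  ∑-ν⊕*ν⊕ {b} {b'} b≢b' = begin
    ∑[ a < N ] (ν (a ⊕ b) * ν (a ⊕ b'))
      ≡⟨ ∑-cong (λ a → ν*ν≡ν+ν-1 (b≢b' ∘ ⊕-cancelˡ a)) ⟩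
    ∑[ a < N ] (ν (a ⊕ b) + ν (a ⊕ b') - + 1)
      ≡⟨ ∑-distrib-+ (λ a → ν (a ⊕ b) + ν (a ⊕ b')) (λ _ → - + 1) ⟩
    ∑[ a < N ] (ν (a ⊕ b) + ν (a ⊕ b')) + ∑[ a < N ] (- + 1)
      ≡⟨ cong₂ _+_ (∑-distrib-+ (λ a → ν (a ⊕ b)) (λ a → ν (a ⊕ b'))) (∑-const N (- + 1)) ⟩
    ∑[ a < N ] ν (a ⊕ b) + ∑[ a < N ] ν (a ⊕ b') + + N * - + 1
      ≡⟨ cong₂ (λ c d → c + d + + N * - + 1) (∑-ν⊕ b) (∑-ν⊕ b') ⟩
    + n + + n + (+ 1 + + n) * - + 1
      ≡⟨ simplify (+ n) ⟩
    + n - + 1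
      ∎
    where
    open ≡-Reasoning
    simplify : ∀ k → k + k + (+ 1 + k) * - + 1 ≡ k - + 1
    simplify = solve-∀

  pairTotal : (b x b' y : Fin N) → ℤ
  pairTotal b x b' y =
    ∑[ a < N ] ((ν (a ⊕ b) * ν (a ⊕ b')) * (+ N + (G (a ⊕ b) x * G (a ⊕ b') y) * ∑[ r < N ] (G (a ⊕ b) r * G (a ⊕ b') r)))

  pairTotal-differentColours : ∀ {b b'} x y → ¬ b ≡ b' → pairTotal b x b' y ≡ (+ n - + 1) * + N
  pairTotal-differentColours {b} {b'} x y b≢b' = begin
    pairTotal b x b' y
      ≡⟨ ∑-cong (λ a → cong (λ P → (ν (a ⊕ b) * ν (a ⊕ b')) * (+ N + (G (a ⊕ b) x * G (a ⊕ b') y) * P))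
                            (hadamard-orthogonal had (a ⊕ b) (a ⊕ b') (b≢b' ∘ ⊕-cancelˡ a))) ⟩
    ∑[ a < N ] ((ν (a ⊕ b) * ν (a ⊕ b')) * (+ N + (G (a ⊕ b) x * G (a ⊕ b') y) * + 0))
      ≡⟨ ∑-cong (λ a → drop-zero (ν (a ⊕ b) * ν (a ⊕ b')) (G (a ⊕ b) x * G (a ⊕ b') y) (+ N)) ⟩
    ∑[ a < N ] ((ν (a ⊕ b) * ν (a ⊕ b')) * + N)
      ≡⟨ *-distribʳ-sum (+ N) (λ a → ν (a ⊕ b) * ν (a ⊕ b')) ⟨
    ∑[ a < N ] (ν (a ⊕ b) * ν (a ⊕ b')) * + N
      ≡⟨ cong (_* + N) (∑-ν⊕*ν⊕ b≢b') ⟩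
    (+ n - + 1) * + N
      ∎
    where
    open ≡-Reasoning
    drop-zero : ∀ c d m → c * (m + d * + 0) ≡ c * m
    drop-zero = solve-∀

  pairTotal-sameColour : ∀ b {x y} → ¬ x ≡ y → pairTotal b x b y ≡ (+ n - + 1) * + N
  pairTotal-sameColour b {x} {y} x≢y = begin
    pairTotal b x b y
      ≡⟨ ∑-cong (λ a → f-at (a ⊕ b)) ⟩
    ∑[ a < N ] f (a ⊕ b)
      ≡⟨ trans (∑-cong λ a → cong f (⊕-comm a b)) (∑-⊕ b f) ⟩
    ∑[ m < N ] f m
      ≡⟨ ℤₚ.+-identityˡ (∑[ i < n ] f (suc i)) ⟩
    ∑[ i < n ] (+ 1 * (+ N + (G (suc i) x * G (suc i) y) * + N))
      ≡⟨ ∑-cong {n} (λ i → ℤₚ.*-identityˡ _) ⟩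
    ∑[ i < n ] (+ N + (G (suc i) x * G (suc i) y) * + N)
      ≡⟨ ∑-distrib-+ (λ _ → + N) (λ i → (G (suc i) x * G (suc i) y) * + N) ⟩
    ∑[ i < n ] (+ N) + ∑[ i < n ] ((G (suc i) x * G (suc i) y) * + N)
      ≡⟨ cong₂ _+_ (∑-const n (+ N)) (sym (*-distribʳ-sum (+ N) (λ i → G (suc i) x * G (suc i) y))) ⟩
    + n * + N + (∑[ i < n ] (G (suc i) x * G (suc i) y)) * + N
      ≡⟨ cong (λ c → + n * + N + c * + N) (columnProduct-belowFirstRow≡-1 x y x≢y) ⟩
    + n * + N + -[1+ 0 ] * + N
      ≡⟨ ℤₚ.*-distribʳ-+ (+ N) (+ n) -[1+ 0 ] ⟨
    (+ n - + 1) * + N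
      ∎
    where
    open ≡-Reasoning
    f : Fin N → ℤ
    f m = ν m * (+ N + (G m x * G m y) * + N)
    f-at : ∀ m → (ν m * ν m) * (+ N + (G m x * G m y) * ∑[ r < N ] (G m r * G m r)) ≡ f m
    f-at m = cong₂ (λ c P → c * (+ N + (G m x * G m y) * P)) (ν² m) (hadamard-row² had m)

  coords : Fin (N ℕ.* N) → Fin N × Fin N
  coords = remQuot {N} N

  coords-injective : ∀ {p p'} → coords p ≡ coords p' → p ≡ p'
  coords-injective {p} {p'} eq =
    trans (sym (combine-remQuot {N} N p)) (trans (cong (uncurry combine) eq) (combine-remQuot {N} N p'))

  blockMember : (a r : Fin N) → Fin N × Fin N → Bool
  blockMember a r (b , x) = member (a ⊕ b) r x

  block : Fin N × Fin N → Subset (N ℕ.* N)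
  block (a , r) = Vec.tabulate (λ p → blockMember a r (coords p))

  blocks : List (Subset (N ℕ.* N))
  blocks = List.tabulate (λ q → block (coords q))

  ∈?-block : ∀ a r p → does (p ∈? block (a , r)) ≡ blockMember a r (coords p)
  ∈?-block a r = ∈?-tabulate (N ℕ.* N) (λ p → blockMember a r (coords p))

  colour : Fin (N ℕ.* N) → Fin N
  colour = quotient N

  2*colourCount≡ν*N : ∀ a r c → + 2 * + colourCount colour (block (a , r)) c ≡ ν (a ⊕ c) * + N
  2*colourCount≡ν*N a r c = begin
    + 2 * + colourCount colour (block (a , r)) c
      ≡⟨ cong (+ 2 *_) (countFin≡∑ (N ℕ.* N) (λ p → (p ∈? block (a , r)) ×-dec (colour p ≟ c))) ⟩
    + 2 * ∑[ p < N ℕ.* N ] 𝟙 (does (p ∈? block (a , r)) ∧ does (colour p ≟ c))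
      ≡⟨ cong (+ 2 *_) (∑-cong in-block-of-colour) ⟩
    + 2 * ∑[ p < N ℕ.* N ] (𝟙 (blockMember a r (coords p)) * δ (colour p) c)
      ≡⟨ cong (+ 2 *_) (∑-remQuot N N (λ b x → 𝟙 (member (a ⊕ b) r x) * δ b c)) ⟩
    + 2 * ∑[ b < N ] ∑[ x < N ] (𝟙 (member (a ⊕ b) r x) * δ b c)
      ≡⟨ cong (+ 2 *_) (∑-cong λ b → δ-to-front b) ⟩
    + 2 * ∑[ b < N ] (δ b c * ∑[ x < N ] 𝟙 (member (a ⊕ b) r x))
      ≡⟨ cong (+ 2 *_) (∑-δ N c (λ b → ∑[ x < N ] 𝟙 (member (a ⊕ b) r x))) ⟩
    + 2 * ∑[ x < N ] 𝟙 (member (a ⊕ c) r x)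
      ≡⟨ 2*∑member≡ν*N (a ⊕ c) r ⟩
    ν (a ⊕ c) * + N
      ∎
    where
    open ≡-Reasoning
    in-block-of-colour : ∀ p → 𝟙 (does (p ∈? block (a , r)) ∧ does (colour p ≟ c)) ≡ 𝟙 (blockMember a r (coords p)) * δ (colour p) c
    in-block-of-colour p = trans (cong (λ e → 𝟙 (e ∧ does (colour p ≟ c))) (∈?-block a r p))
                                 (𝟙-∧ (blockMember a r (coords p)) (does (colour p ≟ c)))
    δ-to-front : ∀ b → ∑[ x < N ] (𝟙 (member (a ⊕ b) r x) * δ b c) ≡ δ b c * ∑[ x < N ] 𝟙 (member (a ⊕ b) r x)
    δ-to-front b = trans (sym (*-distribʳ-sum (δ b c) (λ x → 𝟙 (member (a ⊕ b) r x))))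
                         (ℤₚ.*-comm (∑[ x < N ] 𝟙 (member (a ⊕ b) r x)) (δ b c))

  4*pairCount≡[n-1]*N : ∀ p p' → ¬ p ≡ p' → + 4 * + pairCount blocks p p' ≡ (+ n - + 1) * + N
  4*pairCount≡[n-1]*N p p' p≢p' = begin
    + 4 * + pairCount blocks p p'
      ≡⟨ cong (+ 4 *_) (countList-tabulate≡∑ (λ B → (p ∈? B) ×-dec (p' ∈? B)) (N ℕ.* N) (λ q → block (coords q))) ⟩
    + 4 * ∑[ q < N ℕ.* N ] 𝟙 (does (p ∈? block (coords q)) ∧ does (p' ∈? block (coords q)))
      ≡⟨ cong (+ 4 *_) (∑-cong λ q → both-∈? (coords q)) ⟩
    + 4 * ∑[ q < N ℕ.* N ] (𝟙 (uncurry blockMember (coords q) (b , x)) * 𝟙 (uncurry blockMember (coords q) (b' , y)))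
      ≡⟨ cong (+ 4 *_) (∑-remQuot N N (λ a r → 𝟙 (member (a ⊕ b) r x) * 𝟙 (member (a ⊕ b') r y))) ⟩
    + 4 * ∑[ a < N ] ∑[ r < N ] (𝟙 (member (a ⊕ b) r x) * 𝟙 (member (a ⊕ b') r y))
      ≡⟨ *-distribˡ-sum (+ 4) (λ a → ∑[ r < N ] (𝟙 (member (a ⊕ b) r x) * 𝟙 (member (a ⊕ b') r y))) ⟩
    ∑[ a < N ] (+ 4 * ∑[ r < N ] (𝟙 (member (a ⊕ b) r x) * 𝟙 (member (a ⊕ b') r y)))
      ≡⟨ ∑-cong (λ a → 4*∑member*member (a ⊕ b) (a ⊕ b') x y) ⟩
    pairTotal b x b' y
      ≡⟨ pairTotal-distinct ⟩
    (+ n - + 1) * + N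
      ∎
    where
    open ≡-Reasoning
    b x b' y : Fin N
    b = proj₁ (coords p)
    x = proj₂ (coords p)
    b' = proj₁ (coords p')
    y = proj₂ (coords p')
    both-∈? : ∀ ((a , r) : Fin N × Fin N) →
              𝟙 (does (p ∈? block (a , r)) ∧ does (p' ∈? block (a , r))) ≡ 𝟙 (blockMember a r (b , x)) * 𝟙 (blockMember a r (b' , y))
    both-∈? (a , r) = trans (cong₂ (λ e e′ → 𝟙 (e ∧ e′)) (∈?-block a r p) (∈?-block a r p'))
                            (𝟙-∧ (blockMember a r (b , x)) (blockMember a r (b' , y)))
    pairTotal-distinct : pairTotal b x b' y ≡ (+ n - + 1) * + N
    pairTotal-distinct with b ≟ b'
    ... | no  b≢b' = pairTotal-differentColours x y b≢b'
    ... | yes b≡b' = subst (λ c → pairTotal b x c y ≡ (+ n - + 1) * + N) b≡b'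
                       (pairTotal-sameColour b λ x≡y → p≢p' (coords-injective (cong₂ _,_ b≡b' x≡y)))

  ν-≢zero : ∀ {m} → ¬ m ≡ zero → ν m ≡ + 1
  ν-≢zero {zero}  m≢0 = contradiction refl m≢0
  ν-≢zero {suc _} _   = refl

  colour-surjective : IsColouring (N ℕ.* N) N colour
  colour-surjective c = combine c zero , λ z≡ → trans (cong colour z≡) (cong proj₁ (remQuot-combine c zero))

  2*∣block∣≡N*n : ∀ a r → 2 ℕ.* ∣ block (a , r) ∣ ≡ N ℕ.* n
  2*∣block∣≡N*n a r = +*+-injective 2 ∣ block (a , r) ∣ N n (begin
    + 2 * + ∣ block (a , r) ∣
      ≡⟨ cong (+ 2 *_) (∣tabulate∣≡∑ (N ℕ.* N) (λ p → blockMember a r (coords p))) ⟩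
    + 2 * ∑[ p < N ℕ.* N ] 𝟙 (blockMember a r (coords p))
      ≡⟨ cong (+ 2 *_) (∑-remQuot N N (λ b x → 𝟙 (member (a ⊕ b) r x))) ⟩
    + 2 * ∑[ b < N ] ∑[ x < N ] 𝟙 (member (a ⊕ b) r x)
      ≡⟨ *-distribˡ-sum (+ 2) (λ b → ∑[ x < N ] 𝟙 (member (a ⊕ b) r x)) ⟩
    ∑[ b < N ] (+ 2 * ∑[ x < N ] 𝟙 (member (a ⊕ b) r x))
      ≡⟨ ∑-cong (λ b → 2*∑member≡ν*N (a ⊕ b) r) ⟩
    ∑[ b < N ] (ν (a ⊕ b) * + N)
      ≡⟨ *-distribʳ-sum (+ N) (λ b → ν (a ⊕ b)) ⟨
    (∑[ b < N ] ν (a ⊕ b)) * + N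
      ≡⟨ cong (_* + N) (trans (∑-⊕ a ν) ∑ν) ⟩
    + n * + N
      ≡⟨ ℤₚ.*-comm (+ n) (+ N) ⟩
    + N * + n
      ∎)
    where open ≡-Reasoning

  4*pairCount+N≡N*n : ∀ p p' → ¬ p ≡ p' → 4 ℕ.* pairCount blocks p p' ℕ.+ N ≡ N ℕ.* n
  4*pairCount+N≡N*n p p' p≢p' = ℤₚ.+-injective (begin
    + (4 ℕ.* pairCount blocks p p' ℕ.+ N)   ≡⟨ cong (_+ + N) (ℤₚ.pos-* 4 (pairCount blocks p p')) ⟩
    + 4 * + pairCount blocks p p' + + N     ≡⟨ cong (_+ + N) (4*pairCount≡[n-1]*N p p' p≢p') ⟩
    (+ n - + 1) * + N + + N                 ≡⟨ simplify (+ n) (+ N) ⟩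
    + N * + n                               ≡⟨ ℤₚ.pos-* N n ⟨
    + (N ℕ.* n)                             ∎)
    where
    open ≡-Reasoning
    simplify : ∀ a b → (a - + 1) * b + b ≡ b * a
    simplify = solve-∀

  colourCount-missing≡0 : ∀ a r → colourCount colour (block (a , r)) (⊖ a) ≡ 0
  colourCount-missing≡0 a r = ℕₚ.*-cancelˡ-≡ count 0 2 (+*+-injective 2 count 0 0 (begin
    + 2 * + count       ≡⟨ 2*colourCount≡ν*N a r (⊖ a) ⟩
    ν (a ⊕ ⊖ a) * + N   ≡⟨ cong (λ m → ν m * + N) (⊕-inverseʳ a) ⟩
    + 0                 ∎))
    where
    open ≡-Reasoning
    count : ℕ
    count = colourCount colour (block (a , r)) (⊖ a)

  2*colourCount-present≡N : ∀ a r b → ¬ b ≡ ⊖ a → 2 ℕ.* colourCount colour (block (a , r)) b ≡ N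
  2*colourCount-present≡N a r b b≢⊖a = trans (+*+-injective 2 count 1 N (begin
    + 2 * + count       ≡⟨ 2*colourCount≡ν*N a r b ⟩
    ν (a ⊕ b) * + N     ≡⟨ cong (_* + N) (ν-≢zero a⊕b≢0) ⟩
    + 1 * + N           ∎)) (ℕₚ.*-identityˡ N)
    where
    open ≡-Reasoning
    count : ℕ
    count = colourCount colour (block (a , r)) b
    a⊕b≢0 : ¬ a ⊕ b ≡ zero
    a⊕b≢0 a⊕b≡0 = b≢⊖a (⊕-cancelˡ a (trans a⊕b≡0 (sym (⊕-inverseʳ a))))

  bibdWith0ULSE : 2 ∣ N → 2 ℕ.≤ n → BIBDWith0ULSE (N ℕ.* N) (N C 2) ((N ℕ.* (N ℕ.∸ 2)) / 4) N
  bibdWith0ULSE 2∣N 2≤n = bibdWith0ULSE-fromCounts 2∣N 2≤n blocks colour colour-surjective sizes 4*pairCount+N≡N*n colours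
    where
    sizes : ∀ B → B ∈ blocks → 2 ℕ.* ∣ B ∣ ≡ N ℕ.* n
    sizes B B∈blocks with ∈-tabulate⁻ {f = λ q → block (coords q)} B∈blocks
    ... | q , refl = 2*∣block∣≡N*n (proj₁ (coords q)) (proj₂ (coords q))
    colours : ∀ B → B ∈ blocks → Σ (Fin N) λ c → colourCount colour B c ≡ 0 × (∀ b → ¬ b ≡ c → 2 ℕ.* colourCount colour B b ≡ N)
    colours B B∈blocks with ∈-tabulate⁻ {f = λ q → block (coords q)} B∈blocks
    ... | q , refl = ⊖ a , colourCount-missing≡0 a r , 2*colourCount-present≡N a r
      where
      a r : Fin N
      a = proj₁ (coords q)
      r = proj₂ (coords q)

open import Data.Nat using (zero; _*_; _∸_; _%_; _/_; _<_; z≤n; s≤s)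
open import Data.Nat.Combinatorics using (_C_)
open import Data.Nat.Divisibility using (divides; ∣-trans; m%n≡0⇒n∣m)
open import Data.Product using (_,_)
open import Relation.Binary.PropositionalEquality using (refl)
open HadamardMatrices using (isHadamard-normalise; normalise-firstRow)

theorem5p3 : (ℓ : ℕ) → 0 < ℓ → ℓ % 4 ≡ 0 → HadamardExists ℓ →
    BIBDWith0ULSE (ℓ * ℓ) (ℓ C 2) ((ℓ * (ℓ ∸ 2)) / 4) ℓ
theorem5p3 ℓ 0<ℓ ℓ%4≡0 (_ , had) with m%n≡0⇒n∣m ℓ 4 ℓ%4≡0
... | divides (suc w) refl =
  Construction.bibdWith0ULSE (isHadamard-normalise had) (normalise-firstRow had)
    (∣-trans (divides 2 refl) (divides (suc w) refl)) (s≤s (s≤s z≤n))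
theorem5p3 .0 () _ _ | divides zero refl
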